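{- For every bipartite graph $G=(U,V,E)$, \[\operatorname{fp}(G)\le \min\big(\operatorname{width}(\mathcal P_U),\operatorname{width}(\mathcal P_V)\big).\]
   Context: All graphs are finite and simple. A bipartite graph is a Ferrers graph if it contains no induced copy of $2K_2$ (two disjoint edges with no other edges among their four endpoints); equivalently, the neighborhoods on one side are totally ordered by inclusion. For a bipartite graph $G=(U,V,E)$, $\operatorname{fp}(G)$ is the minimum $k$ such that $E$ can be partitioned as $E=E_1\,\dot\cup\cdots\dot\cup\,E_k$ with each spanning subgraph $(U,V,E_i)$ a Ferrers graph. $\mathcal P_U$ is the neighborhood-inclusion poset on $U$: $u\preceq u'$ iff $N(u)\subseteq N(u')$, and $\operatorname{width}(\mathcal P_U)$ is the maximum size of an antichain, i.e. the maximum number of pairwise inclusion-incomparable sets in the family $\{N(u):u\in U\}$ (multiplicities of equal neighborhoods do not matter). $\mathcal P_V$ and $\operatorname{width}(\mathcal P_V)$ are defined symmetrically using neighborhoods of vertices in $V$. -}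

module Defs where

open import Data.Nat using (ℕ; _≤_; _⊔_; _⊓_)
open import Data.Fin using (Fin; _≟_)
open import Data.Bool using (Bool; true; false)
open import Data.Product using (Σ; ∃; _×_)
open import Data.Empty using (⊥)
open import Relation.Nullary using (¬_; yes; no)
open import Relation.Binary.PropositionalEquality using (_≡_; _≢_)

-- A finite bipartite graph G = (U, V, E) with U = Fin m, V = Fin n,
-- given by its biadjacency relation: E u v ≡ true iff uv is an edge.
BipGraph : ℕ → ℕ → Set
BipGraph m n = Fin m → Fin n → Bool

transpose : ∀ {m n} → BipGraph m n → BipGraph n m
transpose E v u = E u v

-- A bipartite graph is Ferrers iff it contains no induced 2K2:
-- no edges uv, u'v' with u v' and u' v both non-edges.
IsFerrers : ∀ {m n} → BipGraph m n → Set
IsFerrers {m} {n} E =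
  (u u' : Fin m) (v v' : Fin n) →
  E u v ≡ true → E u' v' ≡ true → E u v' ≡ false → E u' v ≡ false → ⊥

-- The spanning subgraph (U, V, E_i) of the colour class i of a colouring c
-- (only the colours of actual edges matter).
colourClass : ∀ {m n k} → BipGraph m n → (Fin m → Fin n → Fin k) → Fin k → BipGraph m n
colourClass E c i u v with E u v
... | false = false
... | true with c u v ≟ i
...   | yes _ = true
...   | no _ = false

-- E can be partitioned into k (possibly empty) Ferrers spanning subgraphs.
-- Since empty parts are Ferrers, this holds iff fp(G) ≤ k.
FerrersPartition : ∀ {m n} → BipGraph m n → ℕ → Set
FerrersPartition {m} {n} E k =
  Σ (Fin m → Fin n → Fin k) λ c → (i : Fin k) → IsFerrers (colourClass E c i)

IsFP : ∀ {m n} → BipGraph m n → ℕ → Set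
IsFP E f = FerrersPartition E f × (∀ k → FerrersPartition E k → f ≤ k)

_⊑[_]_ : ∀ {m n} → Fin m → BipGraph m n → Fin m → Set
_⊑[_]_ {m} {n} u E u' = (v : Fin n) → E u v ≡ true → E u' v ≡ true

-- An antichain of size w in the neighbourhood-inclusion poset P_U:
-- w vertices of U whose neighbourhoods are pairwise inclusion-incomparable
-- (in particular pairwise distinct, so multiplicities do not count).
AntichainU : ∀ {m n} → BipGraph m n → ℕ → Set
AntichainU {m} E w =
  Σ (Fin w → Fin m) λ a → (i j : Fin w) → i ≢ j → ¬ (a i ⊑[ E ] a j)

IsWidthU : ∀ {m n} → BipGraph m n → ℕ → Set
IsWidthU E w = AntichainU E w × (∀ k → AntichainU E k → k ≤ w)

IsWidthV : ∀ {m n} → BipGraph m n → ℕ → Set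
IsWidthV E w = IsWidthU (transpose E) w

-- Dilworth's theorem for a finite preorder, by Galvin's induction: remove a maximal element a of
-- S, split S - a into k chains with a k-element antichain, and let top c be the greatest element
-- of colour c that lies in some k-element antichain; the tops form an antichain. If a is
-- incomparable to every top, a joins them and gets a new colour. Otherwise top c ≲ a, and the
-- chain K formed by a and the elements of colour c below top c meets every k-element antichain
-- of S - a, so by induction S ─ K splits into fewer than k chains together with an antichain
-- of the same size, and K is one more chain.
-- Vertices in one chain of P_U have nested neighbourhoods, so colouring each edge by the chain
-- of its U-endpoint is a partition into Ferrers graphs with as many parts as some antichain;
-- transposing gives the same for P_V.
module Submission where

open import Defs
open import Data.Bool using (true; false)
import Data.Bool.Properties as Bool
open import Data.Empty using (⊥-elim)
open import Data.Fin using (Fin; zero; suc; toℕ; fromℕ<; punchOut; _≟_)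
open import Data.Fin.Properties
  using (any?; all?; toℕ-fromℕ<; toℕ-injective; fromℕ<-injective; injective⇒≤; punchOut-injective)
open import Data.Fin.Subset using (Subset; _∈_; _∉_; _⊆_; _⊂_; _─_; _-_; ⁅_⁆; ⊤; Empty)
open import Data.Fin.Subset.Properties
  using ( _∈?_; nonempty?; ∈⊤; x∈⁅y⁆⇒x≡y; x∈p∧x∉q⇒x∈p─q; x∈p∧x≢y⇒x∈p-y; p─q⊆p
        ; p∩q≢∅⇒p─q⊂p; x∈p∩q⁺; x∈p⇒p-x⊂p)
open import Data.Fin.Subset.Induction using (⊂-wellFounded)
open import Data.List using (List; []; _∷_; allFin)
import Data.List.Membership.Propositional as List
open import Data.List.Membership.Propositional.Properties using (∈-allFin)
import Data.List.Relation.Unary.Any as Any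
open import Data.Nat using (ℕ; zero; suc; _≤_; _<_; _⊓_)
import Data.Nat.Properties as ℕ
open import Data.Product using (∃; _×_; _,_; proj₁; proj₂)
open import Data.Sum using (_⊎_; inj₁; inj₂; [_,_]′)
open import Data.Vec using (Vec; []; _∷_; lookup; tabulate; there)
open import Data.Vec.Properties using (lookup∘tabulate; lookup⇒[]=; []=⇒lookup)
open import Function using (_∘_; id; flip)
open import Function.Definitions using (Injective)
open import Induction.WellFounded using (WfRec; module All)
open import Relation.Binary using (Rel; Decidable; IsPreorder)
open import Relation.Binary.PropositionalEquality
  using (_≡_; _≢_; refl; sym; trans; cong; subst; subst₂; isEquivalence)
open import Relation.Nullary using (¬_; Dec; yes; no; does; contradiction)
open import Relation.Nullary.Decidable using (map′; _×-dec_; _⊎-dec_; _→-dec_; ¬?; dec-true)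
open import Relation.Unary using (Pred)
import Relation.Unary as U

injective⇒surjective : ∀ {k} {f : Fin k → Fin k} → Injective _≡_ _≡_ f → ∀ c → ∃ λ i → f i ≡ c
injective⇒surjective {suc k} {f} f-injective c with any? (λ i → f i ≟ c)
... | yes hit = hit
... | no miss = contradiction (injective⇒≤ avoid-c-injective) ℕ.1+n≰n
  where
  avoid-c : Fin (suc k) → Fin k
  avoid-c i = punchOut (miss ∘ (i ,_) ∘ sym)

  avoid-c-injective : Injective _≡_ _≡_ avoid-c
  avoid-c-injective = f-injective ∘ punchOut-injective {i = c} _ _

anyVec? : ∀ {m p} k {P : Pred (Vec (Fin m) k) p} → U.Decidable P → Dec (∃ P)
anyVec? zero    P? = map′ ([] ,_) (λ { ([] , p) → p }) (P? [])
anyVec? (suc k) P? = map′ (λ (x , xs , p) → x ∷ xs , p) (λ { (x ∷ xs , p) → x , xs , p })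
  (any? λ x → anyVec? k (P? ∘ (x ∷_)))

x∈p─q⇒x∉q : ∀ {n} {x : Fin n} {p q : Subset n} → x ∈ p ─ q → x ∉ q
x∈p─q⇒x∉q {p = _ ∷ _} {q = _ ∷ _} (there x∈p─q) (there x∈q) = x∈p─q⇒x∉q x∈p─q x∈q

toSubset : ∀ {n p} {P : Pred (Fin n) p} → U.Decidable P → Subset n
toSubset P? = tabulate (does ∘ P?)

module _ {n p} {P : Pred (Fin n) p} (P? : U.Decidable P) {x : Fin n} where

  ∈toSubset⁺ : P x → x ∈ toSubset P?
  ∈toSubset⁺ Px = lookup⇒[]= x _ (trans (lookup∘tabulate (does ∘ P?) x) (dec-true (P? x) Px))

  ∈toSubset⁻ : x ∈ toSubset P? → P x
  ∈toSubset⁻ x∈P with P? x | trans (sym (lookup∘tabulate (does ∘ P?) x)) ([]=⇒lookup x∈P)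
  ... | yes Px | _ = Px

module FinitePreorder {m ℓ} {_≲_ : Rel (Fin m) ℓ}
  (≲-isPreorder : IsPreorder _≡_ _≲_) (_≲?_ : Decidable _≲_) where

  open IsPreorder ≲-isPreorder using (reflexive) renaming (trans to ≲-trans)

  Comparable : Rel (Fin m) ℓ
  Comparable x y = x ≲ y ⊎ y ≲ x

  comparable? : Decidable Comparable
  comparable? x y = x ≲? y ⊎-dec y ≲? x

  module _ {q} {Q : Pred (Fin m) q} (Q? : U.Decidable Q) where

    maximal-among : ∃ Q → (xs : List (Fin m)) →
                    ∃ λ a → Q a × ∀ {z} → z List.∈ xs → Q z → a ≲ z → z ≲ a
    maximal-among (x , Qx) [] = x , Qx , λ ()
    maximal-among Q≠∅ (y ∷ ys) with maximal-among Q≠∅ ys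
    ... | a , Qa , a-max with y ≲? a | Q? y ×-dec a ≲? y
    ...   | yes y≲a | _ = a , Qa , λ { (Any.here refl) _ _ → y≲a ; (Any.there z∈ys) → a-max z∈ys }
    ...   | no _ | no ¬Qy×a≲y =
      a , Qa , λ { (Any.here refl) Qy a≲y → contradiction (Qy , a≲y) ¬Qy×a≲y
                 ; (Any.there z∈ys) → a-max z∈ys }
    ...   | no _ | yes (Qy , a≲y) =
      y , Qy , λ { (Any.here refl) _ y≲y → y≲y
                 ; (Any.there z∈ys) Qz y≲z → ≲-trans (a-max z∈ys Qz (≲-trans a≲y y≲z)) a≲y }

    maximal : ∃ Q → ∃ λ a → Q a × ∀ {z} → Q z → a ≲ z → z ≲ a
    maximal Q≠∅ with maximal-among Q≠∅ (allFin m)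
    ... | a , Qa , a-max = a , Qa , a-max (∈-allFin _)

    greatest : (∀ {x y} → Q x → Q y → Comparable x y) → ∃ Q → ∃ λ g → Q g × ∀ {z} → Q z → z ≲ g
    greatest Q-chain Q≠∅ with maximal Q≠∅
    ... | g , Qg , g-max = g , Qg , λ Qz → [ g-max Qz , id ]′ (Q-chain Qg Qz)

  IsChain : Pred (Subset m) ℓ
  IsChain K = ∀ {x y} → x ∈ K → y ∈ K → Comparable x y

  singleton-isChain : ∀ a → IsChain ⁅ a ⁆
  singleton-isChain a x∈⁅a⁆ y∈⁅a⁆ =
    inj₁ (reflexive (trans (x∈⁅y⁆⇒x≡y a x∈⁅a⁆) (sym (x∈⁅y⁆⇒x≡y a y∈⁅a⁆))))

  record IsAntichain (S : Subset m) {k} (v : Vec (Fin m) k) : Set ℓ where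
    constructor isAntichain
    field
      within : ∀ i → lookup v i ∈ S
      incomparable : ∀ i j → i ≢ j → ¬ lookup v i ≲ lookup v j

  isAntichain? : ∀ S {k} (v : Vec (Fin m) k) → Dec (IsAntichain S v)
  isAntichain? S v = map′ (λ (within , incomparable) → isAntichain within incomparable)
                          (λ (isAntichain within incomparable) → within , incomparable)
    (all? (λ i → lookup v i ∈? S)
      ×-dec all? λ i → all? λ j → ¬? (i ≟ j) →-dec ¬? (lookup v i ≲? lookup v j))

  IsAntichain-mono : ∀ {S T k} {v : Vec (Fin m) k} → S ⊆ T → IsAntichain S v → IsAntichain T v
  IsAntichain-mono S⊆T (isAntichain within incomparable) = isAntichain (S⊆T ∘ within) incomparable

  ∷-isAntichain : ∀ {S a k} {v : Vec (Fin m) k} → a ∈ S → (∀ i → ¬ Comparable a (lookup v i)) →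
                  IsAntichain S v → IsAntichain S (a ∷ v)
  ∷-isAntichain {S} {a} {v = v} a∈S a⊥v (isAntichain within incomparable) =
    isAntichain ∷-within ∷-incomparable
    where
    ∷-within : ∀ i → lookup (a ∷ v) i ∈ S
    ∷-within zero    = a∈S
    ∷-within (suc i) = within i

    ∷-incomparable : ∀ i j → i ≢ j → ¬ lookup (a ∷ v) i ≲ lookup (a ∷ v) j
    ∷-incomparable zero    zero    0≢0 = contradiction refl 0≢0
    ∷-incomparable zero    (suc j) _   = a⊥v j ∘ inj₁
    ∷-incomparable (suc i) zero    _   = a⊥v i ∘ inj₂
    ∷-incomparable (suc i) (suc j) i≢j = incomparable i j (i≢j ∘ cong suc)

  record ChainColouring (S : Subset m) (k : ℕ) : Set ℓ where
    field
      colour : Fin m → ℕ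
      colour< : ∀ {x} → x ∈ S → colour x < k
      monochromatic⇒comparable : ∀ {x y} → x ∈ S → y ∈ S → colour x ≡ colour y → Comparable x y

  module _ {S k} (C : ChainColouring S k) where
    open ChainColouring C

    private
      colourOf : ∀ {k′} {v : Vec (Fin m) k′} → IsAntichain S v → Fin k′ → Fin k
      colourOf v-anti i = fromℕ< (colour< (IsAntichain.within v-anti i))

      colourOf-injective : ∀ {k′} {v : Vec (Fin m) k′} (v-anti : IsAntichain S v) →
                           Injective _≡_ _≡_ (colourOf v-anti)
      colourOf-injective (isAntichain within incomparable) {i} {j} same with i ≟ j
      ... | yes i≡j = i≡j
      ... | no i≢j = ⊥-elim ([ incomparable i j i≢j , incomparable j i (i≢j ∘ sym) ]′
              (monochromatic⇒comparable (within i) (within j) (fromℕ<-injective _ _ _ _ same)))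

    antichain-size≤ : ∀ {k′} {v : Vec (Fin m) k′} → IsAntichain S v → k′ ≤ k
    antichain-size≤ v-anti = injective⇒≤ (colourOf-injective v-anti)

    antichain-meets-every-colour : ∀ {v : Vec (Fin m) k} → IsAntichain S v →
                                   ∀ c → ∃ λ i → colour (lookup v i) ≡ toℕ c
    antichain-meets-every-colour v-anti c with injective⇒surjective (colourOf-injective v-anti) c
    ... | i , hit = i , trans (sym (toℕ-fromℕ< _)) (cong toℕ hit)

  addChain : ∀ {S K k k′} → IsChain K → ChainColouring (S ─ K) k → k < k′ → ChainColouring S k′
  addChain {S} {K} {k} K-chain C k<k′ = record
    { colour = colour′
    ; colour< = colour′<
    ; monochromatic⇒comparable = colour′-comparable
    }
    where
    open ChainColouring C

    colour′ : Fin m → ℕ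
    colour′ x with x ∈? K
    ... | yes _ = k
    ... | no _  = colour x

    colour′< : ∀ {x} → x ∈ S → colour′ x < _
    colour′< {x} x∈S with x ∈? K
    ... | yes _   = k<k′
    ... | no  x∉K = ℕ.<-trans (colour< (x∈p∧x∉q⇒x∈p─q x∈S x∉K)) k<k′

    colour′-comparable : ∀ {x y} → x ∈ S → y ∈ S → colour′ x ≡ colour′ y → Comparable x y
    colour′-comparable {x} {y} x∈S y∈S same with x ∈? K | y ∈? K
    ... | yes x∈K | yes y∈K = K-chain x∈K y∈K
    ... | yes _   | no  y∉K = ⊥-elim (ℕ.<-irrefl (sym same) (colour< (x∈p∧x∉q⇒x∈p─q y∈S y∉K)))
    ... | no  x∉K | yes _   = ⊥-elim (ℕ.<-irrefl same (colour< (x∈p∧x∉q⇒x∈p─q x∈S x∉K)))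
    ... | no  x∉K | no  y∉K =
      monochromatic⇒comparable (x∈p∧x∉q⇒x∈p─q x∈S x∉K) (x∈p∧x∉q⇒x∈p─q y∈S y∉K) same

  record DilworthPair (S : Subset m) : Set ℓ where
    field
      width : ℕ
      chains : ChainColouring S width
      antichain : Vec (Fin m) width
      antichain-isAntichain : IsAntichain S antichain

  empty-dilworthPair : ∀ {S} → Empty S → DilworthPair S
  empty-dilworthPair S-empty = record
    { width = 0
    ; chains = record
      { colour = λ _ → 0
      ; colour< = λ x∈S → contradiction (_ , x∈S) S-empty
      ; monochromatic⇒comparable = λ x∈S → contradiction (_ , x∈S) S-empty
      }
    ; antichain = []
    ; antichain-isAntichain = isAntichain (λ ()) (λ ())
    }

  module Tops {T : Subset m} (D : DilworthPair T) where
    open DilworthPair D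
    open ChainColouring chains

    InMaximumAntichain : Pred (Fin m) ℓ
    InMaximumAntichain x = ∃ λ (v : Vec (Fin m) width) → IsAntichain T v × ∃ λ i → lookup v i ≡ x

    Candidate : Fin width → Pred (Fin m) ℓ
    Candidate c x = x ∈ T × colour x ≡ toℕ c × InMaximumAntichain x

    private
      candidate? : ∀ c → U.Decidable (Candidate c)
      candidate? c x = x ∈? T ×-dec colour x ℕ.≟ toℕ c
        ×-dec anyVec? width (λ v → isAntichain? T v ×-dec any? λ i → lookup v i ≟ x)

      candidates-comparable : ∀ {c x y} → Candidate c x → Candidate c y → Comparable x y
      candidates-comparable (x∈T , x-colour , _) (y∈T , y-colour , _) =
        monochromatic⇒comparable x∈T y∈T (trans x-colour (sym y-colour))

      candidate-exists : ∀ c → ∃ (Candidate c)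
      candidate-exists c with antichain-meets-every-colour chains antichain-isAntichain c
      ... | i , colour≡c = lookup antichain i
                         , IsAntichain.within antichain-isAntichain i , colour≡c
                         , antichain , antichain-isAntichain , i , refl

      top-spec : ∀ c → ∃ λ t → Candidate c t × ∀ {z} → Candidate c z → z ≲ t
      top-spec c = greatest (candidate? c) candidates-comparable (candidate-exists c)

    top : Fin width → Fin m
    top c = proj₁ (top-spec c)

    top-candidate : ∀ c → Candidate c (top c)
    top-candidate c = proj₁ (proj₂ (top-spec c))

    top-greatest : ∀ c {z} → Candidate c z → z ≲ top c
    top-greatest c = proj₂ (proj₂ (top-spec c))

    top-incomparable : ∀ c d → c ≢ d → ¬ top c ≲ top d
    top-incomparable c d c≢d top-c≲top-d with top-candidate d
    ... | _ , top-d-colour , v , v-anti , j , vj≡top-d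
      with antichain-meets-every-colour chains v-anti c
    ...   | i , vi-colour = IsAntichain.incomparable v-anti i j i≢j
            (subst (lookup v i ≲_) (sym vj≡top-d) (≲-trans vi≲top-c top-c≲top-d))
      where
      vi≲top-c : lookup v i ≲ top c
      vi≲top-c = top-greatest c (IsAntichain.within v-anti i , vi-colour , v , v-anti , i , refl)

      i≢j : i ≢ j
      i≢j refl =
        c≢d (toℕ-injective (trans (sym vi-colour) (trans (cong colour vj≡top-d) top-d-colour)))

    tops : Vec (Fin m) width
    tops = tabulate top

    tops-isAntichain : IsAntichain T tops
    tops-isAntichain = isAntichain
      (λ c → subst (_∈ T) (sym (lookup∘tabulate top c)) (proj₁ (top-candidate c)))
      (λ c d c≢d → subst₂ (λ x y → ¬ x ≲ y)
                          (sym (lookup∘tabulate top c)) (sym (lookup∘tabulate top d))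
                          (top-incomparable c d c≢d))

  module GalvinStep {S : Subset m} {a : Fin m}
    (a∈S : a ∈ S) (a-maximal : ∀ {z} → z ∈ S → a ≲ z → z ≲ a) (D : DilworthPair (S - a)) where

    open DilworthPair D
    open ChainColouring chains
    open Tops D

    extend-antichain : (∀ c → ¬ Comparable a (lookup tops c)) → DilworthPair S
    extend-antichain a⊥tops = record
      { width = suc width
      ; chains = addChain (singleton-isChain a) chains (ℕ.n<1+n width)
      ; antichain = a ∷ tops
      ; antichain-isAntichain =
          ∷-isAntichain a∈S a⊥tops (IsAntichain-mono (p─q⊆p S ⁅ a ⁆) tops-isAntichain)
      }

    module _ (c : Fin width) (top≲a : top c ≲ a) where

      InK : Pred (Fin m) ℓ
      InK z = z ≡ a ⊎ (z ∈ S - a × colour z ≡ toℕ c × z ≲ top c)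

      inK? : U.Decidable InK
      inK? z = z ≟ a ⊎-dec (z ∈? S - a ×-dec colour z ℕ.≟ toℕ c ×-dec z ≲? top c)

      K : Subset m
      K = toSubset inK?

      K-isChain : IsChain K
      K-isChain x∈K y∈K = comparable (∈toSubset⁻ inK? x∈K) (∈toSubset⁻ inK? y∈K)
        where
        comparable : ∀ {x y} → InK x → InK y → Comparable x y
        comparable (inj₁ refl) (inj₁ refl) = inj₁ (reflexive refl)
        comparable (inj₁ refl) (inj₂ (_ , _ , y≲top)) = inj₂ (≲-trans y≲top top≲a)
        comparable (inj₂ (_ , _ , x≲top)) (inj₁ refl) = inj₁ (≲-trans x≲top top≲a)
        comparable (inj₂ (x∈S-a , x-colour , _)) (inj₂ (y∈S-a , y-colour , _)) =
          monochromatic⇒comparable x∈S-a y∈S-a (trans x-colour (sym y-colour))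

      a∈K : a ∈ K
      a∈K = ∈toSubset⁺ inK? (inj₁ refl)

      S─K⊂S : S ─ K ⊂ S
      S─K⊂S = p∩q≢∅⇒p─q⊂p S K (a , x∈p∩q⁺ (a∈S , a∈K))

      S─K⊆S-a : S ─ K ⊆ S - a
      S─K⊆S-a z∈S─K = x∈p∧x≢y⇒x∈p-y (p─q⊆p S K z∈S─K) λ { refl → x∈p─q⇒x∉q z∈S─K a∈K }

      maximum-antichain-meets-K : ∀ {v : Vec (Fin m) width} → IsAntichain (S - a) v →
                                  ∃ λ i → lookup v i ∈ K
      maximum-antichain-meets-K {v} v-anti with antichain-meets-every-colour chains v-anti c
      ... | i , vi-colour = i , ∈toSubset⁺ inK? (inj₂ (vi∈S-a , vi-colour , vi≲top))
        where
        vi∈S-a : lookup v i ∈ S - a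
        vi∈S-a = IsAntichain.within v-anti i

        vi≲top : lookup v i ≲ top c
        vi≲top = top-greatest c (vi∈S-a , vi-colour , v , v-anti , i , refl)

      S─K-antichain-size< : ∀ {k} {v : Vec (Fin m) k} → IsAntichain (S ─ K) v → k < width
      S─K-antichain-size< {k} {v} v-anti =
        ℕ.≤∧≢⇒< (antichain-size≤ chains v-anti′) λ { refl → avoids-K (maximum-antichain-meets-K v-anti′) }
        where
        v-anti′ : IsAntichain (S - a) v
        v-anti′ = IsAntichain-mono S─K⊆S-a v-anti

        avoids-K : ¬ ∃ λ i → lookup v i ∈ K
        avoids-K (i , vi∈K) = x∈p─q⇒x∉q (IsAntichain.within v-anti i) vi∈K

      extend-chain : DilworthPair (S ─ K) → DilworthPair S
      extend-chain D′ = record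
        { width = width
        ; chains = addChain K-isChain (DilworthPair.chains D′)
                     (S─K-antichain-size< (DilworthPair.antichain-isAntichain D′))
        ; antichain = antichain
        ; antichain-isAntichain = IsAntichain-mono (p─q⊆p S ⁅ a ⁆) antichain-isAntichain
        }

    galvin-step : (∀ {T} → T ⊂ S → DilworthPair T) → DilworthPair S
    galvin-step rec with any? (λ c → comparable? a (lookup tops c))
    ... | no a⊥tops = extend-antichain (λ c → a⊥tops ∘ (c ,_))
    ... | yes (c , a~top) = extend-chain c top≲a (rec (S─K⊂S c top≲a))
      where
      top∈S : top c ∈ S
      top∈S = p─q⊆p S ⁅ a ⁆ (proj₁ (top-candidate c))

      top≲a : top c ≲ a
      top≲a = [ a-maximal top∈S , id ]′ (subst (Comparable a) (lookup∘tabulate top c) a~top)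

  dilworth : ∀ S → DilworthPair S
  dilworth = All.wfRec ⊂-wellFounded ℓ DilworthPair step
    where
    step : ∀ S → WfRec _⊂_ DilworthPair S → DilworthPair S
    step S rec with nonempty? S
    ... | no S-empty = empty-dilworthPair S-empty
    ... | yes S-nonempty with maximal (_∈? S) S-nonempty
    ...   | a , a∈S , a-maximal = GalvinStep.galvin-step a∈S a-maximal (rec (x∈p⇒p-x⊂p a∈S)) rec

module _ {m n k} {E : BipGraph m n} {c : Fin m → Fin n → Fin k} {i : Fin k} {u : Fin m} {v : Fin n} where

  colourClass-false : colourClass E c i u v ≡ false → E u v ≡ true → c u v ≢ i
  colourClass-false uv∉class Euv with E u v
  ... | true with c u v ≟ i
  ...   | no cuv≢i = cuv≢i

  colourClass-true : colourClass E c i u v ≡ true → E u v ≡ true × c u v ≡ i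
  colourClass-true uv∈class with E u v
  ... | true with c u v ≟ i
  ...   | yes cuv≡i = refl , cuv≡i

colourClass-transpose : ∀ {m n k} (E : BipGraph m n) (c : Fin n → Fin m → Fin k) i u v →
                        colourClass (transpose E) c i v u ≡ colourClass E (flip c) i u v
colourClass-transpose E c i u v with E u v
... | false = refl
... | true with c v u ≟ i
...   | yes _ = refl
...   | no _  = refl

FerrersPartition-transpose : ∀ {m n k} (E : BipGraph m n) →
                             FerrersPartition (transpose E) k → FerrersPartition E k
FerrersPartition-transpose E (c , ferrers) = flip c , ferrers′
  where
  ferrers′ : ∀ i → IsFerrers (colourClass E (flip c) i)
  ferrers′ i u u′ v v′ uv u′v′ uv′ u′v = ferrers i v v′ u u′ (via uv) (via u′v′) (via u′v) (via uv′)
    where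
    via : ∀ {x y b} → colourClass E (flip c) i x y ≡ b → colourClass (transpose E) c i y x ≡ b
    via {x} {y} = trans (colourClass-transpose E c i x y)

⊑-isPreorder : ∀ {m n} (E : BipGraph m n) → IsPreorder _≡_ (_⊑[ E ]_)
⊑-isPreorder E = record
  { isEquivalence = isEquivalence
  ; reflexive = λ { refl _ Euv → Euv }
  ; trans = λ u⊑u′ u′⊑u″ v Euv → u′⊑u″ v (u⊑u′ v Euv)
  }

⊑-decidable : ∀ {m n} (E : BipGraph m n) → Decidable (_⊑[ E ]_)
⊑-decidable E u u′ = all? λ v → E u v Bool.≟ true →-dec E u′ v Bool.≟ true

rowChains⇒FerrersPartition : ∀ {m n k} {E : BipGraph m n} (colour : Fin m → Fin k) →
                             (∀ u u′ → colour u ≡ colour u′ → u ⊑[ E ] u′ ⊎ u′ ⊑[ E ] u) →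
                             FerrersPartition E k
rowChains⇒FerrersPartition {E = E} colour chain = (λ u _ → colour u) , ferrers
  where
  ferrers : ∀ i → IsFerrers (colourClass E (λ u _ → colour u) i)
  ferrers i u u′ v v′ uv u′v′ uv′ u′v
    with colourClass-true {E = E} uv | colourClass-true {E = E} u′v′
  ... | Euv , u-colour | Eu′v′ , u′-colour with chain u u′ (trans u-colour (sym u′-colour))
  ...   | inj₁ u⊑u′ = colourClass-false {E = E} u′v (u⊑u′ v Euv) u′-colour
  ...   | inj₂ u′⊑u = colourClass-false {E = E} uv′ (u′⊑u v′ Eu′v′) u-colour

dilworthᵁ : ∀ {m n} (E : BipGraph m n) → ∃ λ k → FerrersPartition E k × AntichainU E k
dilworthᵁ {m} E = width , rowChains⇒FerrersPartition colourᶠ chain , lookup antichain , incomparable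
  where
  open FinitePreorder (⊑-isPreorder E) (⊑-decidable E)
  open DilworthPair (dilworth ⊤)
  open ChainColouring chains
  open IsAntichain antichain-isAntichain

  colourᶠ : Fin m → Fin width
  colourᶠ u = fromℕ< (colour< (∈⊤ {x = u}))

  chain : ∀ u u′ → colourᶠ u ≡ colourᶠ u′ → u ⊑[ E ] u′ ⊎ u′ ⊑[ E ] u
  chain u u′ same = monochromatic⇒comparable ∈⊤ ∈⊤ (fromℕ<-injective _ _ _ _ same)

dilworthⱽ : ∀ {m n} (E : BipGraph m n) → ∃ λ k → FerrersPartition E k × AntichainU (transpose E) k
dilworthⱽ E with dilworthᵁ (transpose E)
... | k , partition , antichain = k , FerrersPartition-transpose E partition , antichain

theorem4p2 : ∀ {m n} (E : BipGraph m n) (f wU wV : ℕ) →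
    IsFP E f → IsWidthU E wU → IsWidthV E wV → f ≤ wU ⊓ wV
theorem4p2 E f wU wV (_ , f-minimal) (_ , wU-maximal) (_ , wV-maximal) =
  ℕ.⊓-glb (fp≤ E (dilworthᵁ E) wU-maximal) (fp≤ (transpose E) (dilworthⱽ E) wV-maximal)
  where
  fp≤ : ∀ {m′ n′} (E′ : BipGraph m′ n′) {w} → (∃ λ k → FerrersPartition E k × AntichainU E′ k) →
        (∀ k → AntichainU E′ k → k ≤ w) → f ≤ w
  fp≤ _ (k , partition , antichain) w-maximal =
    ℕ.≤-trans (f-minimal k partition) (w-maximal k antichain)
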